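{- Let $\tilde\alpha=b\,\tilde\rho$ be any generalized infinite composition with first part $b\ge0$. (1) If $b=0$, then $G_{0\,\tilde\rho}(x_1,x_2,\ldots)=G_{\tilde\rho}(x_2,x_3,\ldots)$; in particular $G_{\tilde\alpha}$ does not involve $x_1$. (2) If $b>0$, then $G_{\tilde\alpha}=x_1\,G_{(b-1)\,\tilde\rho}+M_{\tilde\alpha}(x_2,x_3,\ldots)$ for a series $M_{\tilde\alpha}(x_2,x_3,\ldots)$ in the variables $x_2,x_3,\ldots$ only, and $M_{\tilde\alpha}\in\mathcal{J}^{(e)}(x_2,x_3,\ldots)$ whenever $G_{\tilde\alpha}\in\mathcal{J}^{(e)}$.
   Context: A standard composition is a finite sequence of positive integers; for a composition $\alpha=[\alpha_1,\ldots,\alpha_k]$ of $d$ let $D(\alpha)=\{\alpha_1,\ldots,\alpha_1+\cdots+\alpha_{k-1}\}$ and $F_\alpha(x_1,x_2,\ldots)=\sum x_{j_1}\cdots x_{j_d}$ over $j_1\le\cdots\le j_d$ with $j_i<j_{i+1}$ whenever $i\in D(\alpha)$. A generalized composition is a finite or infinite sequence of nonnegative integers with finite sum $d(\cdot)$; $\ell(\cdot)$ is the length of a finite one; juxtaposition denotes concatenation. Every infinite generalized composition can be written $\tilde\alpha=\tilde\nu\,0\,0\cdots$ with $\tilde\nu$ finite and either empty or with nonzero last part. The series $G_{\tilde\alpha}\in\mathbb{Q}[[x_1,x_2,\ldots]]$ are defined recursively on $\ell(\tilde\nu)$: if $\tilde\nu=\nu$ has no zero parts, $G_{\tilde\alpha}=F_\nu(x_1,x_2,\ldots)$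 (so $G_{0\,0\cdots}=1$); otherwise write uniquely $\tilde\nu=\tilde\gamma\,0\,a\,\beta$ with $a>0$, $\beta$ a (possibly empty) standard composition and $\tilde\gamma$ a (possibly empty) generalized composition, put $k=\ell(\tilde\gamma)+1$ and define $G_{\tilde\alpha}=G_{\tilde\gamma\,a\,\beta\,0\,0\cdots}-x_k\,G_{\tilde\gamma\,(a-1)\,\beta\,0\,0\cdots}$. For a series $P$, $P(x_2,x_3,\ldots)$ denotes $P$ with each $x_i$ replaced by $x_{i+1}$. A generalized composition reaches level $e$ if it factors as $\tilde\pi\tilde\rho$ with $\tilde\pi$ finite nonempty and $d(\tilde\pi)-\ell(\tilde\pi)\ge e$; $\mathcal{J}^{(e)}$ is the ideal of $\mathbb{Q}[[x_1,x_2,\ldots]]$ generated by the $F_\alpha(x_1,x_2,\ldots)$ for standard compositions $\alpha$ reaching level $e$, and $\mathcal{J}^{(e)}(x_2,x_3,\ldots)$ is the ideal obtained by replacing each $x_i$ by $x_{i+1}$. -}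

module Defs where

open import Data.Nat as ℕ using (ℕ; zero; suc; _≤_; _<_; _∸_; _<ᵇ_; _≤ᵇ_; _≡ᵇ_)
open import Data.Integer using (+_)
open import Data.Rational using (ℚ; 0ℚ; 1ℚ; _/_) renaming (_+_ to _+ℚ_; _*_ to _*ℚ_; -_ to -ℚ_)
open import Data.List using (List; []; _∷_; [_]; _++_; length; map; concatMap; zipWith; replicate; foldr; filterᵇ; upTo)
open import Data.List.Properties using (≡-dec)
open import Data.Nat.ListAction using (sum)
open import Data.Bool.ListAction using (any)
open import Data.List.Relation.Unary.All using (All)
open import Data.Bool using (Bool; true; false; if_then_else_; _∧_)
open import Data.Product using (Σ; ∃; ∃₂; _×_; _,_; proj₁; proj₂)
open import Relation.Nullary using (¬_)
open import Relation.Nullary.Decidable using (⌊_⌋)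
open import Relation.Binary.PropositionalEquality using (_≡_)
open import Data.Maybe using (Maybe; just; nothing)

-- Monomials in x₁, x₂, … : exponent lists (entry i = exponent of x_{i+1}).
-- Lists differing by trailing zeros denote the same monomial; 'trim'
-- gives the canonical representative.

trimCons : ℕ → List ℕ → List ℕ
trimCons zero [] = []
trimCons (suc k) [] = suc k ∷ []
trimCons x (y ∷ ys) = x ∷ y ∷ ys

trim : List ℕ → List ℕ
trim [] = []
trim (x ∷ xs) = trimCons x (trim xs)

_==ᴸ_ : List ℕ → List ℕ → Bool
u ==ᴸ v = ⌊ ≡-dec ℕ._≟_ u v ⌋

-- Formal power series in ℚ[[x₁, x₂, …]]: a coefficient function on
-- monomials, always read through the canonical representative.

record Series : Set where
  constructor mkSeries
  field coeff : List ℕ → ℚ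
open Series public

_⟦_⟧ : Series → List ℕ → ℚ
P ⟦ m ⟧ = coeff P (trim m)

infix 4 _≈_
_≈_ : Series → Series → Set
P ≈ Q = ∀ m → P ⟦ m ⟧ ≡ Q ⟦ m ⟧

ℕtoℚ : ℕ → ℚ
ℕtoℚ n = (+ n) / 1

sumℚ : List ℚ → ℚ
sumℚ = foldr _+ℚ_ 0ℚ

0S : Series
0S = mkSeries (λ _ → 0ℚ)

infixl 6 _+S_ _-S_
infixl 7 _*S_

_+S_ : Series → Series → Series
P +S Q = mkSeries (λ m → P ⟦ m ⟧ +ℚ Q ⟦ m ⟧)

-S_ : Series → Series
-S P = mkSeries (λ m → -ℚ (P ⟦ m ⟧))

_-S_ : Series → Series → Series
P -S Q = P +S (-S Q)

divs : List ℕ → List (List ℕ)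
divs [] = [] ∷ []
divs (k ∷ ks) = concatMap (λ i → map (i ∷_) (divs ks)) (upTo (suc k))

_*S_ : Series → Series → Series
P *S Q = mkSeries (λ m → let t = trim m in
  sumℚ (map (λ d → P ⟦ d ⟧ *ℚ Q ⟦ zipWith _∸_ t d ⟧) (divs t)))

-- the variable x_k (k ≥ 1); x 0 is unused junk (= 1)
xmon : ℕ → List ℕ
xmon zero = []
xmon (suc i) = replicate i 0 ++ [ 1 ]

x : ℕ → Series
x k = mkSeries (λ m → if trim m ==ᴸ xmon k then 1ℚ else 0ℚ)

-- P(x₂, x₃, …): substitute x_i ↦ x_{i+1}
shift : Series → Series
shift P = mkSeries (λ m → go (trim m))
  where
  go : List ℕ → ℚ
  go [] = P ⟦ [] ⟧
  go (zero ∷ m') = P ⟦ m' ⟧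
  go (suc _ ∷ _) = 0ℚ

NoX1 : Series → Set
NoX1 P = ∀ k m → P ⟦ suc k ∷ m ⟧ ≡ 0ℚ

Dset : List ℕ → List ℕ
Dset [] = []
Dset (a ∷ []) = []
Dset (a ∷ b ∷ rest) = a ∷ map (a ℕ.+_) (Dset (b ∷ rest))

seqs : ℕ → ℕ → List (List ℕ)
seqs L zero = [] ∷ []
seqs L (suc d) = concatMap (λ i → map (suc i ∷_) (seqs L d)) (upTo L)

admissible : List ℕ → ℕ → List ℕ → Bool
admissible D i [] = true
admissible D i (a ∷ []) = true
admissible D i (a ∷ b ∷ rest) =
  (if any (λ t → t ≡ᵇ i) D then a <ᵇ b else a ≤ᵇ b) ∧ admissible D (suc i) (b ∷ rest)

addVar : ℕ → List ℕ → List ℕ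
addVar zero m = m
addVar (suc zero) [] = 1 ∷ []
addVar (suc zero) (e ∷ es) = suc e ∷ es
addVar (suc (suc i)) [] = 0 ∷ addVar (suc i) []
addVar (suc (suc i)) (e ∷ es) = e ∷ addVar (suc i) es

expo : List ℕ → List ℕ
expo = foldr addVar []

-- F_α = Σ x_{j₁}⋯x_{j_d} over j₁ ≤ ⋯ ≤ j_d, strict at D(α).
-- The coefficient of a monomial m counts such sequences j with
-- x_{j₁}⋯x_{j_d} = m; all such j have entries ≤ length (trim m).
F : List ℕ → Series
F α = mkSeries (λ m → let t = trim m in
  ℕtoℚ (length (filterᵇ (λ j → admissible (Dset α) 1 j ∧ (trim (expo j) ==ᴸ t))
                        (seqs (length t) (sum α)))))

-- The series G_α̃ for infinite generalized compositions α̃, represented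
-- by a finite list (followed implicitly by 0 0 ⋯).

-- splitLast ν = just (γ , s) iff ν = γ ++ 0 ∷ s with s zero-free
splitLast : List ℕ → Maybe (List ℕ × List ℕ)
splitLast [] = nothing
splitLast (a ∷ as) with splitLast as
... | just (γ , s) = just (a ∷ γ , s)
splitLast (zero ∷ as) | nothing = just ([] , as)
splitLast (suc _ ∷ as) | nothing = nothing

-- G with fuel; argument ν is ν̃ (trimmed: empty or last part nonzero)
Gf : ℕ → List ℕ → Series
Gf fuel ν with splitLast ν
Gf fuel ν | nothing = F ν
Gf zero ν | just _ = 0S     -- unreachable when fuel = length ν
Gf (suc f) ν | just (γ , []) = Gf f (trim γ)   -- unreachable for trimmed ν
Gf (suc f) ν | just (γ , a ∷ β) =
  Gf f (trim (γ ++ a ∷ β)) -S x (suc (length γ)) *S Gf f (trim (γ ++ (a ∸ 1) ∷ β))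

G : List ℕ → Series
G α = Gf (length (trim α)) (trim α)

Standard : List ℕ → Set
Standard α = All (0 <_) α

ReachesLevel : ℕ → List ℕ → Set
ReachesLevel e α = ∃₂ λ π ρ → α ≡ π ++ ρ × ¬ (π ≡ []) × length π ℕ.+ e ≤ sum π

lincomb : List (Series × List ℕ) → Series
lincomb = foldr (λ p acc → proj₁ p *S F (proj₂ p) +S acc) 0S

InJ : ℕ → Series → Set
InJ e P = Σ (List (Series × List ℕ)) λ cs →
  All (λ p → Standard (proj₂ p) × ReachesLevel e (proj₂ p)) cs × P ≈ lincomb cs

InShiftJ : ℕ → Series → Set
InShiftJ e N = ∃ λ P → InJ e P × N ≈ shift P

-- Everything is read off coefficientwise in x₁. For zero-free ν the coefficient of a monomial in
-- F_ν is 1 exactly when its sorted index sequence is admissible for D(ν) and has degree d(ν), so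
-- F_ν(0, x₂, x₃, …) = F_ν(x₂, x₃, …), and removing a factor x₁ from a monomial corresponds to
-- lowering the first part of ν. Once a part is prepended, every step of the recursion for G
-- multiplies by some x_k with k ≥ 2, which acts on the x₁-coefficients as x_{k-1}; hence
-- G_{0ρ̃} = G_ρ̃(x₂, x₃, …) and [x₁^{k+1}] G_{(b+1)ρ̃} = [x₁^k] G_{bρ̃} follow by induction on the
-- length of ρ̃, with the zero-free case supplied by F. Part (2) is then the decomposition
-- P = x₁ Q + P(0, x₂, x₃, …), and setting x₁ = 0 maps Σ cᵢ F_{αᵢ} to Σ cᵢ(0, x₂, …) F_{αᵢ}(x₂, x₃, …).

module Submission where

open import Defs
open import Data.Nat as ℕ using (ℕ; zero; suc; _+_; _≤_; _<_; _∸_; _<ᵇ_; _≤ᵇ_; _≡ᵇ_; z≤n; s≤s)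
import Data.Nat.Properties as ℕP
open import Data.Nat.ListAction using (sum)
open import Data.Rational using (ℚ; 0ℚ; 1ℚ) renaming (_+_ to _+ℚ_; _*_ to _*ℚ_; -_ to -ℚ_)
import Data.Rational.Properties as ℚP
open import Data.List using (List; []; _∷_; [_]; _++_; length; map; concatMap; zipWith; replicate; foldr; filterᵇ; upTo; applyUpTo)
import Data.List.Properties as ListP
open import Data.List.Relation.Unary.All as All using (All; []; _∷_; universal)
open import Data.List.Relation.Unary.Linked using (Linked; []; [-]; _∷_)
import Data.List.Relation.Unary.All.Properties as AllP
open import Data.Bool using (Bool; true; false; if_then_else_; _∧_; T; T?)
import Data.Bool.Properties as BoolP
open import Data.Bool.ListAction using (any; or)
open import Data.Product using (∃; _×_; _,_; proj₁; proj₂)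
open import Data.Sum using (_⊎_; inj₁; inj₂)
open import Data.Maybe using (just; nothing)
open import Data.Empty using (⊥-elim)
open import Data.Unit using (⊤; tt)
open import Function using (_∘_; case_of_; Equivalence)
open import Relation.Binary.PropositionalEquality hiding ([_])
open import Data.Nat.Induction using (<-wellFounded)
open import Induction.WellFounded using (Acc; acc)
open import Relation.Nullary.Decidable using (Dec; does; _because_; isYes; toWitness; fromWitness)

trimCons-suc : ∀ k l → trimCons (suc k) l ≡ suc k ∷ l
trimCons-suc k [] = refl
trimCons-suc k (_ ∷ _) = refl

trimCons-∷ : ∀ a b l → trimCons a (b ∷ l) ≡ a ∷ b ∷ l
trimCons-∷ zero b l = refl
trimCons-∷ (suc a) b l = refl

trimCons-cases : ∀ a l → trimCons a l ≡ a ∷ l ⊎ (a ≡ 0 × l ≡ [])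
trimCons-cases zero [] = inj₂ (refl , refl)
trimCons-cases (suc a) [] = inj₁ refl
trimCons-cases a (b ∷ l) = inj₁ (trimCons-∷ a b l)

trim-trimCons : ∀ a l → trim (trimCons a l) ≡ trimCons a (trim l)
trim-trimCons zero [] = refl
trim-trimCons (suc a) [] = refl
trim-trimCons a (b ∷ l) rewrite trimCons-∷ a b l = refl

trim-idem : ∀ l → trim (trim l) ≡ trim l
trim-idem [] = refl
trim-idem (a ∷ l) = trans (trim-trimCons a (trim l)) (cong (trimCons a) (trim-idem l))

trim-∷-trim : ∀ a l → trim (a ∷ trim l) ≡ trim (a ∷ l)
trim-∷-trim a l = cong (trimCons a) (trim-idem l)

trim-∷-trimmed : ∀ a b l → trim (b ∷ l) ≡ b ∷ l → trim (a ∷ b ∷ l) ≡ a ∷ b ∷ l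
trim-∷-trimmed a b l t = trans (cong (trimCons a) t) (trimCons-∷ a b l)

trim-suc-∷-trimmed : ∀ a l → trim l ≡ l → trim (suc a ∷ l) ≡ suc a ∷ l
trim-suc-∷-trimmed a l t = trans (cong (trimCons (suc a)) t) (trimCons-suc a l)

trimmed-tail : ∀ a l → trim (a ∷ l) ≡ a ∷ l → trim l ≡ l
trimmed-tail a l t with trim l in eq
trimmed-tail zero l () | []
trimmed-tail (suc a) l t | [] = ListP.∷-injectiveʳ t
trimmed-tail a l t | b ∷ l′ = ListP.∷-injectiveʳ (trans (sym (trimCons-∷ a b l′)) t)

trim-replicate-0 : ∀ n → trim (replicate n 0) ≡ []
trim-replicate-0 zero = refl
trim-replicate-0 (suc n) rewrite trim-replicate-0 n = refl

trim-∷ʳ-0 : ∀ l → trim (l ++ [ 0 ]) ≡ trim l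
trim-∷ʳ-0 [] = refl
trim-∷ʳ-0 (a ∷ l) = cong (trimCons a) (trim-∷ʳ-0 l)

length-trim : ∀ l → length (trim l) ≤ length l
length-trim [] = z≤n
length-trim (a ∷ l) = ℕP.≤-trans (length-trimCons a (trim l)) (s≤s (length-trim l))
  where
  length-trimCons : ∀ a l → length (trimCons a l) ≤ suc (length l)
  length-trimCons zero [] = z≤n
  length-trimCons (suc a) [] = ℕP.≤-refl
  length-trimCons a (b ∷ l) rewrite trimCons-∷ a b l = ℕP.≤-refl

⟦⟧-trim : ∀ P l → P ⟦ trim l ⟧ ≡ P ⟦ l ⟧
⟦⟧-trim P l = cong (coeff P) (trim-idem l)

⟦⟧-∷-trim : ∀ P a l → P ⟦ a ∷ trim l ⟧ ≡ P ⟦ a ∷ l ⟧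
⟦⟧-∷-trim P a l = cong (coeff P) (trim-∷-trim a l)

≡⇒≈ : ∀ {P Q} → P ≡ Q → P ≈ Q
≡⇒≈ refl m = refl

==ᴸ-∷ : ∀ a b u v → ((a ∷ u) ==ᴸ (b ∷ v)) ≡ ((a ≡ᵇ b) ∧ (u ==ᴸ v))
==ᴸ-∷ a b u v = trans (isYes≗does _) (cong ((a ≡ᵇ b) ∧_) (sym (isYes≗does (ListP.≡-dec ℕ._≟_ u v))))
  where
  isYes≗does : ∀ {A : Set} (d : Dec A) → isYes d ≡ does d
  isYes≗does (true because _) = refl
  isYes≗does (false because _) = refl

==ᴸ-refl : ∀ u → (u ==ᴸ u) ≡ true
==ᴸ-refl u = Equivalence.to BoolP.T-≡ (fromWitness refl)

sumℚ-++ : ∀ xs ys → sumℚ (xs ++ ys) ≡ sumℚ xs +ℚ sumℚ ys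
sumℚ-++ [] ys = sym (ℚP.+-identityˡ _)
sumℚ-++ (q ∷ xs) ys rewrite sumℚ-++ xs ys = sym (ℚP.+-assoc q _ _)

sumℚ-map-concatMap : ∀ {A B : Set} (f : B → ℚ) (g : A → List B) xs →
  sumℚ (map f (concatMap g xs)) ≡ sumℚ (map (λ a → sumℚ (map f (g a))) xs)
sumℚ-map-concatMap f g [] = refl
sumℚ-map-concatMap f g (a ∷ xs) = begin
  sumℚ (map f (g a ++ concatMap g xs))             ≡⟨ cong sumℚ (ListP.map-++ f (g a) (concatMap g xs)) ⟩
  sumℚ (map f (g a) ++ map f (concatMap g xs))     ≡⟨ sumℚ-++ (map f (g a)) _ ⟩
  sumℚ (map f (g a)) +ℚ sumℚ (map f (concatMap g xs)) ≡⟨ cong (sumℚ (map f (g a)) +ℚ_) (sumℚ-map-concatMap f g xs) ⟩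
  sumℚ (map (λ a → sumℚ (map f (g a))) (a ∷ xs))   ∎
  where open ≡-Reasoning

sumℚ-map-cong : ∀ {A : Set} {f g : A → ℚ} → (∀ a → f a ≡ g a) → ∀ xs → sumℚ (map f xs) ≡ sumℚ (map g xs)
sumℚ-map-cong eq xs = cong sumℚ (ListP.map-cong eq xs)

sumℚ-map-zero : ∀ {A : Set} {f : A → ℚ} {xs} → All (λ a → f a ≡ 0ℚ) xs → sumℚ (map f xs) ≡ 0ℚ
sumℚ-map-zero [] = refl
sumℚ-map-zero (e ∷ es) rewrite e | sumℚ-map-zero es = refl

sumℚ-divs-∷ : ∀ (f : List ℕ → ℚ) e t → sumℚ (map f (divs (e ∷ t))) ≡
  sumℚ (map (λ i → sumℚ (map (λ d → f (i ∷ d)) (divs t))) (upTo (suc e)))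
sumℚ-divs-∷ f e t = trans (sumℚ-map-concatMap f (λ i → map (i ∷_) (divs t)) (upTo (suc e)))
  (sumℚ-map-cong (λ i → cong sumℚ (sym (ListP.map-∘ (divs t)))) (upTo (suc e)))

sumℚ-divs-const : ∀ t (f : List ℕ → ℚ) → (∀ d → (trim d ==ᴸ []) ≡ false → f d ≡ 0ℚ) →
  sumℚ (map f (divs t)) ≡ f (replicate (length t) 0)
sumℚ-divs-const [] f h = ℚP.+-identityʳ _
sumℚ-divs-const (k ∷ t) f h = begin
  sumℚ (map f (divs (k ∷ t)))                                       ≡⟨ sumℚ-divs-∷ f k t ⟩
  sumℚ (map (λ d → f (0 ∷ d)) (divs t)) +ℚ sumℚ (map H (applyUpTo suc k))
    ≡⟨ cong₂ _+ℚ_ (sumℚ-divs-const t (λ d → f (0 ∷ d)) h-0∷) (sumℚ-map-zero (AllP.applyUpTo⁺₂ suc k H-suc)) ⟩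
  f (0 ∷ replicate (length t) 0) +ℚ 0ℚ                              ≡⟨ ℚP.+-identityʳ _ ⟩
  f (replicate (length (k ∷ t)) 0)                                  ∎
  where
  open ≡-Reasoning
  H : ℕ → ℚ
  H i = sumℚ (map (λ d → f (i ∷ d)) (divs t))
  H-suc : ∀ i → H (suc i) ≡ 0ℚ
  H-suc i = sumℚ-map-zero (universal (λ d → h (suc i ∷ d) (cong (_==ᴸ []) (trimCons-suc i (trim d)))) (divs t))
  h-0∷ : ∀ d → (trim d ==ᴸ []) ≡ false → f (0 ∷ d) ≡ 0ℚ
  h-0∷ d ne with trim d in eq
  ... | [] = case ne of λ ()
  ... | b ∷ l = h (0 ∷ d) (cong (λ l → trimCons 0 l ==ᴸ []) eq)

+S-⟦⟧ : ∀ P Q m → (P +S Q) ⟦ m ⟧ ≡ P ⟦ m ⟧ +ℚ Q ⟦ m ⟧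
+S-⟦⟧ P Q m = cong₂ _+ℚ_ (⟦⟧-trim P m) (⟦⟧-trim Q m)

-S-⟦⟧ : ∀ P Q m → (P -S Q) ⟦ m ⟧ ≡ P ⟦ m ⟧ +ℚ -ℚ (Q ⟦ m ⟧)
-S-⟦⟧ P Q m = cong₂ _+ℚ_ (⟦⟧-trim P m) (cong -ℚ_ (trans (⟦⟧-trim Q (trim m)) (⟦⟧-trim Q m)))

convolution : Series → Series → List ℕ → ℚ
convolution P Q t = sumℚ (map (λ d → P ⟦ d ⟧ *ℚ Q ⟦ zipWith _∸_ t d ⟧) (divs t))

*S-⟦⟧ : ∀ P Q m → (P *S Q) ⟦ m ⟧ ≡ convolution P Q (trim m)
*S-⟦⟧ P Q m = cong (convolution P Q) (trim-idem m)

*S-congʳ : ∀ P Q Q′ → Q ≈ Q′ → P *S Q ≈ P *S Q′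
*S-congʳ P Q Q′ eq m = sumℚ-map-cong (λ d → cong (P ⟦ d ⟧ *ℚ_) (eq (zipWith _∸_ (trim (trim m)) d))) (divs (trim (trim m)))

*S-zeroʳ : ∀ P Q → Q ≈ 0S → P *S Q ≈ 0S
*S-zeroʳ P Q eq m = sumℚ-map-zero (universal term-zero (divs (trim (trim m))))
  where
  term-zero : ∀ d → P ⟦ d ⟧ *ℚ Q ⟦ zipWith _∸_ (trim (trim m)) d ⟧ ≡ 0ℚ
  term-zero d = trans (cong (P ⟦ d ⟧ *ℚ_) (eq (zipWith _∸_ (trim (trim m)) d))) (ℚP.*-zeroʳ (P ⟦ d ⟧))

*ℚ-zeroˡ-≡ : ∀ {a} b → a ≡ 0ℚ → a *ℚ b ≡ 0ℚ
*ℚ-zeroˡ-≡ b refl = ℚP.*-zeroˡ b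

coeff₁ : ℕ → Series → Series
coeff₁ e P = mkSeries (λ m → P ⟦ e ∷ m ⟧)

coeff₁-⟦⟧ : ∀ e P m → coeff₁ e P ⟦ m ⟧ ≡ P ⟦ e ∷ m ⟧
coeff₁-⟦⟧ e P m = ⟦⟧-∷-trim P e m

-- Multiplication by a variable

x-⟦⟧ : ∀ k l → x k ⟦ l ⟧ ≡ (if trim l ==ᴸ xmon k then 1ℚ else 0ℚ)
x-⟦⟧ k l = cong (λ t → if t ==ᴸ xmon k then 1ℚ else 0ℚ) (trim-idem l)

xmon-suc-∷ : ∀ k → ∃ λ a → ∃ λ v → xmon (suc k) ≡ a ∷ v
xmon-suc-∷ zero = 1 , [] , refl
xmon-suc-∷ (suc k) = 0 , _ , refl

x-suc-⟦[]⟧ : ∀ k → x (suc k) ⟦ [] ⟧ ≡ 0ℚ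
x-suc-⟦[]⟧ k with xmon-suc-∷ k
... | a , v , eq rewrite eq = refl

x₁-⟦0∷⟧ : ∀ d → x 1 ⟦ 0 ∷ d ⟧ ≡ 0ℚ
x₁-⟦0∷⟧ d rewrite x-⟦⟧ 1 (0 ∷ d) with trim d
... | [] = refl
... | b ∷ l rewrite ==ᴸ-∷ 0 1 (b ∷ l) [] = refl

x₁-⟦1∷⟧ : ∀ d → x 1 ⟦ 1 ∷ d ⟧ ≡ (if trim d ==ᴸ [] then 1ℚ else 0ℚ)
x₁-⟦1∷⟧ d rewrite x-⟦⟧ 1 (1 ∷ d) | trimCons-suc 0 (trim d) | ==ᴸ-∷ 1 1 (trim d) [] = refl

x₁-⟦2+∷⟧ : ∀ i d → x 1 ⟦ suc (suc i) ∷ d ⟧ ≡ 0ℚ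
x₁-⟦2+∷⟧ i d rewrite x-⟦⟧ 1 (suc (suc i) ∷ d) | trimCons-suc (suc i) (trim d) | ==ᴸ-∷ (suc (suc i)) 1 (trim d) [] = refl

x-2+-⟦0∷⟧ : ∀ k d → x (suc (suc k)) ⟦ 0 ∷ d ⟧ ≡ x (suc k) ⟦ d ⟧
x-2+-⟦0∷⟧ k d rewrite x-⟦⟧ (suc (suc k)) (0 ∷ d) | x-⟦⟧ (suc k) d with trim d
... | [] with xmon-suc-∷ k
...   | a , v , eq rewrite eq = refl
x-2+-⟦0∷⟧ k d | b ∷ l rewrite ==ᴸ-∷ 0 0 (b ∷ l) (xmon (suc k)) = refl

x-2+-⟦suc∷⟧ : ∀ k i d → x (suc (suc k)) ⟦ suc i ∷ d ⟧ ≡ 0ℚ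
x-2+-⟦suc∷⟧ k i d rewrite x-⟦⟧ (suc (suc k)) (suc i ∷ d) | trimCons-suc i (trim d) | ==ᴸ-∷ (suc i) 0 (trim d) (xmon (suc k)) = refl

x*-⟦const⟧ : ∀ k Q m → trim m ≡ [] → (x (suc k) *S Q) ⟦ m ⟧ ≡ 0ℚ
x*-⟦const⟧ k Q m eq rewrite *S-⟦⟧ (x (suc k)) Q m | eq | x-suc-⟦[]⟧ k = trans (ℚP.+-identityʳ _) (ℚP.*-zeroˡ (Q ⟦ [] ⟧))

x₁*-⟦0∷⟧ : ∀ Q m → (x 1 *S Q) ⟦ 0 ∷ m ⟧ ≡ 0ℚ
x₁*-⟦0∷⟧ Q m with trimCons-cases 0 (trim m)
... | inj₂ (_ , eq) = x*-⟦const⟧ 0 Q (0 ∷ m) (cong (trimCons 0) eq)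
... | inj₁ eq rewrite *S-⟦⟧ (x 1) Q (0 ∷ m) | eq =
  trans (sumℚ-divs-∷ _ 0 (trim m))
  (trans (ℚP.+-identityʳ _) (sumℚ-map-zero (universal (λ d → *ℚ-zeroˡ-≡ _ (x₁-⟦0∷⟧ d)) (divs (trim m)))))

x₁*-⟦suc∷⟧ : ∀ Q e m → (x 1 *S Q) ⟦ suc e ∷ m ⟧ ≡ Q ⟦ e ∷ m ⟧
x₁*-⟦suc∷⟧ Q e m rewrite *S-⟦⟧ (x 1) Q (suc e ∷ m) | trimCons-suc e (trim m) = begin
  convolution (x 1) Q (suc e ∷ t)                         ≡⟨ sumℚ-divs-∷ f (suc e) t ⟩
  H 0 +ℚ (H 1 +ℚ sumℚ (map H (applyUpTo (suc ∘ suc) e)))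
    ≡⟨ cong₂ _+ℚ_ H-0 (cong₂ _+ℚ_ H-1 (sumℚ-map-zero (AllP.applyUpTo⁺₂ (suc ∘ suc) e H-2+))) ⟩
  0ℚ +ℚ (Q ⟦ e ∷ m ⟧ +ℚ 0ℚ)                                ≡⟨ trans (ℚP.+-identityˡ _) (ℚP.+-identityʳ _) ⟩
  Q ⟦ e ∷ m ⟧                                              ∎
  where
  open ≡-Reasoning
  t = trim m
  f : List ℕ → ℚ
  f d = x 1 ⟦ d ⟧ *ℚ Q ⟦ zipWith _∸_ (suc e ∷ t) d ⟧
  H : ℕ → ℚ
  H i = sumℚ (map (λ d → f (i ∷ d)) (divs t))
  H-0 : H 0 ≡ 0ℚ
  H-0 = sumℚ-map-zero (universal (λ d → *ℚ-zeroˡ-≡ _ (x₁-⟦0∷⟧ d)) (divs t))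
  H-2+ : ∀ i → H (suc (suc i)) ≡ 0ℚ
  H-2+ i = sumℚ-map-zero (universal (λ d → *ℚ-zeroˡ-≡ _ (x₁-⟦2+∷⟧ i d)) (divs t))
  zeros = replicate (length t) 0
  zipWith-∸-zeros : ∀ t → zipWith _∸_ t (replicate (length t) 0) ≡ t
  zipWith-∸-zeros [] = refl
  zipWith-∸-zeros (k ∷ t) = cong (k ∷_) (zipWith-∸-zeros t)
  H-1 : H 1 ≡ Q ⟦ e ∷ m ⟧
  H-1 = begin
    H 1
      ≡⟨ sumℚ-divs-const t (λ d → f (1 ∷ d))
           (λ d ne → *ℚ-zeroˡ-≡ _ (trans (x₁-⟦1∷⟧ d) (cong (λ b → if b then 1ℚ else 0ℚ) ne))) ⟩
    x 1 ⟦ 1 ∷ zeros ⟧ *ℚ Q ⟦ e ∷ zipWith _∸_ t zeros ⟧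
      ≡⟨ cong (_*ℚ Q ⟦ e ∷ zipWith _∸_ t zeros ⟧)
           (trans (x₁-⟦1∷⟧ zeros) (cong (λ l → if l ==ᴸ [] then 1ℚ else 0ℚ) (trim-replicate-0 (length t)))) ⟩
    1ℚ *ℚ Q ⟦ e ∷ zipWith _∸_ t zeros ⟧
      ≡⟨ ℚP.*-identityˡ _ ⟩
    Q ⟦ e ∷ zipWith _∸_ t zeros ⟧
      ≡⟨ cong (λ l → Q ⟦ e ∷ l ⟧) (zipWith-∸-zeros t) ⟩
    Q ⟦ e ∷ trim m ⟧
      ≡⟨ ⟦⟧-∷-trim Q e m ⟩
    Q ⟦ e ∷ m ⟧ ∎

x-2+*-⟦∷⟧ : ∀ k Q e m → (x (suc (suc k)) *S Q) ⟦ e ∷ m ⟧ ≡ (x (suc k) *S coeff₁ e Q) ⟦ m ⟧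
x-2+*-⟦∷⟧ k Q e m with trimCons-cases e (trim m)
... | inj₂ (refl , eq) = trans (x*-⟦const⟧ (suc k) Q (0 ∷ m) (cong (trimCons 0) eq)) (sym (x*-⟦const⟧ k (coeff₁ 0 Q) m eq))
... | inj₁ eq rewrite *S-⟦⟧ (x (suc (suc k))) Q (e ∷ m) | *S-⟦⟧ (x (suc k)) (coeff₁ e Q) m | eq = begin
  convolution (x (suc (suc k))) Q (e ∷ t)                   ≡⟨ sumℚ-divs-∷ f e t ⟩
  H 0 +ℚ sumℚ (map H (applyUpTo suc e))                     ≡⟨ cong (H 0 +ℚ_) (sumℚ-map-zero (AllP.applyUpTo⁺₂ suc e H-suc)) ⟩
  H 0 +ℚ 0ℚ                                                 ≡⟨ ℚP.+-identityʳ (H 0) ⟩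
  H 0
    ≡⟨ sumℚ-map-cong (λ d → cong₂ _*ℚ_ (x-2+-⟦0∷⟧ k d) (sym (coeff₁-⟦⟧ e Q (zipWith _∸_ t d)))) (divs t) ⟩
  convolution (x (suc k)) (coeff₁ e Q) t                    ∎
  where
  open ≡-Reasoning
  t = trim m
  f : List ℕ → ℚ
  f d = x (suc (suc k)) ⟦ d ⟧ *ℚ Q ⟦ zipWith _∸_ (e ∷ t) d ⟧
  H : ℕ → ℚ
  H i = sumℚ (map (λ d → f (i ∷ d)) (divs t))
  H-suc : ∀ i → H (suc i) ≡ 0ℚ
  H-suc i = sumℚ-map-zero (universal (λ d → *ℚ-zeroˡ-≡ _ (x-2+-⟦suc∷⟧ k i d)) (divs t))

*S-⟦0∷⟧ : ∀ P Q m → (P *S Q) ⟦ 0 ∷ m ⟧ ≡ (coeff₁ 0 P *S coeff₁ 0 Q) ⟦ m ⟧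
*S-⟦0∷⟧ P Q m rewrite *S-⟦⟧ P Q (0 ∷ m) | *S-⟦⟧ (coeff₁ 0 P) (coeff₁ 0 Q) m with trim m
... | [] = refl
... | b ∷ l = trans (sumℚ-divs-∷ f 0 (b ∷ l)) (trans (ℚP.+-identityʳ _)
      (sumℚ-map-cong (λ d → cong₂ _*ℚ_ (sym (coeff₁-⟦⟧ 0 P d)) (sym (coeff₁-⟦⟧ 0 Q (zipWith _∸_ (b ∷ l) d))))
        (divs (b ∷ l))))
  where
  f : List ℕ → ℚ
  f d = P ⟦ d ⟧ *ℚ Q ⟦ zipWith _∸_ (0 ∷ b ∷ l) d ⟧

-- The monomials of F_α

-- The weakly increasing index sequence of a monomial: x₁² x₃ ↦ [1, 1, 3].
indices : List ℕ → List ℕ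
indices [] = []
indices (e ∷ t) = replicate e 1 ++ map suc (indices t)

indices-trim : ∀ l → indices (trim l) ≡ indices l
indices-trim [] = refl
indices-trim (a ∷ l) = trans (indices-trimCons a (trim l)) (cong (λ s → replicate a 1 ++ map suc s) (indices-trim l))
  where
  indices-trimCons : ∀ a l → indices (trimCons a l) ≡ indices (a ∷ l)
  indices-trimCons zero [] = refl
  indices-trimCons (suc a) [] = refl
  indices-trimCons a (b ∷ l) rewrite trimCons-∷ a b l = refl

sum-trim : ∀ l → sum (trim l) ≡ sum l
sum-trim [] = refl
sum-trim (a ∷ l) = trans (sum-trimCons a (trim l)) (cong (a +_) (sum-trim l))
  where
  sum-trimCons : ∀ a l → sum (trimCons a l) ≡ sum (a ∷ l)
  sum-trimCons zero [] = refl
  sum-trimCons (suc a) [] = refl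
  sum-trimCons a (b ∷ l) rewrite trimCons-∷ a b l = refl

indices-bounded : ∀ t → All (λ a → 0 < a × a ≤ length t) (indices t)
indices-bounded [] = []
indices-bounded (e ∷ t) = AllP.++⁺ (AllP.replicate⁺ e (s≤s z≤n , s≤s z≤n))
  (AllP.map⁺ (All.map (λ (_ , a≤) → s≤s z≤n , s≤s a≤) (indices-bounded t)))

indices-positive : ∀ t → All (0 <_) (indices t)
indices-positive t = All.map proj₁ (indices-bounded t)

length-indices : ∀ t → length (indices t) ≡ sum t
length-indices [] = refl
length-indices (e ∷ t) rewrite ListP.length-++ (replicate e 1) {map suc (indices t)}
  | ListP.length-replicate e {1} | ListP.length-map suc (indices t) | length-indices t = refl

addVar-suc-∷ : ∀ a l → ∃ λ b → ∃ λ l′ → addVar (suc a) l ≡ b ∷ l′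
addVar-suc-∷ zero [] = _ , _ , refl
addVar-suc-∷ zero (_ ∷ _) = _ , _ , refl
addVar-suc-∷ (suc a) [] = _ , _ , refl
addVar-suc-∷ (suc a) (_ ∷ _) = _ , _ , refl

expo-map-suc : ∀ j → All (0 <_) j → expo (map suc j) ≡ trimCons 0 (expo j)
expo-map-suc [] [] = refl
expo-map-suc (suc a ∷ j) (_ ∷ pos) rewrite expo-map-suc j pos = addVar-trimCons-0 a (expo j)
  where
  addVar-trimCons-0 : ∀ a l → addVar (suc (suc a)) (trimCons 0 l) ≡ trimCons 0 (addVar (suc a) l)
  addVar-trimCons-0 a [] with addVar-suc-∷ a []
  ... | b , l′ , eq rewrite eq = refl
  addVar-trimCons-0 zero (_ ∷ _) = refl
  addVar-trimCons-0 (suc a) (_ ∷ _) = refl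

expo-indices : ∀ t → expo (indices t) ≡ trim t
expo-indices [] = refl
expo-indices (e ∷ t) rewrite ListP.foldr-++ addVar [] (replicate e 1) (map suc (indices t))
  | expo-map-suc (indices t) (indices-positive t) | expo-indices t = addVar-1-replicate e (trim t)
  where
  addVar-1-replicate : ∀ e l → foldr addVar (trimCons 0 l) (replicate e 1) ≡ trimCons e l
  addVar-1-replicate zero l = refl
  addVar-1-replicate (suc e) l rewrite addVar-1-replicate e l with trimCons-cases e l
  ... | inj₁ eq rewrite eq | trimCons-suc e l = refl
  ... | inj₂ (refl , refl) = refl

trim-expo : ∀ j → All (0 <_) j → trim (expo j) ≡ expo j
trim-expo [] [] = refl
trim-expo (suc a ∷ j) (_ ∷ pos) = trim-addVar a (expo j) (trim-expo j pos)
  where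
  trim-addVar : ∀ a l → trim l ≡ l → trim (addVar (suc a) l) ≡ addVar (suc a) l
  trim-addVar zero [] t = refl
  trim-addVar zero (b ∷ l) t rewrite trimmed-tail b l t = trimCons-suc b l
  trim-addVar (suc a) [] t with addVar-suc-∷ a [] | trim-addVar a [] refl
  ... | b , l′ , eq | t′ rewrite eq | t′ = refl
  trim-addVar (suc a) (b ∷ l) t with addVar-suc-∷ a l | trim-addVar a l (trimmed-tail b l t)
  ... | c , l′ , eq | t′ rewrite eq | t′ = trimCons-∷ b c l′

HeadAtLeast : ℕ → List ℕ → Set
HeadAtLeast a [] = ⊤
HeadAtLeast a (b ∷ _) = a ≤ b

HeadAtLeast-map-suc : ∀ {a} l → HeadAtLeast (suc a) (map suc l) → HeadAtLeast a l
HeadAtLeast-map-suc [] h = tt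
HeadAtLeast-map-suc (_ ∷ _) (s≤s h) = h

indices-addVar : ∀ a l → HeadAtLeast (suc a) (indices l) → indices (addVar (suc a) l) ≡ suc a ∷ indices l
indices-addVar zero [] h = refl
indices-addVar zero (_ ∷ _) h = refl
indices-addVar (suc a) [] h rewrite indices-addVar a [] tt = refl
indices-addVar (suc a) (zero ∷ l) h rewrite indices-addVar a l (HeadAtLeast-map-suc (indices l) h) = refl
indices-addVar (suc a) (suc _ ∷ l) (s≤s ())

indices-expo : ∀ j → All (0 <_) j → Linked _≤_ j → indices (expo j) ≡ j
indices-expo [] _ _ = refl
indices-expo (zero ∷ _) (() ∷ _) _
indices-expo (suc a ∷ []) _ _ = indices-addVar a [] tt
indices-expo (suc a ∷ b ∷ r) (_ ∷ pos) (a≤b ∷ sorted) rewrite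
    indices-addVar a (expo (b ∷ r)) (subst (HeadAtLeast (suc a)) (sym (indices-expo (b ∷ r) pos sorted)) a≤b)
  | indices-expo (b ∷ r) pos sorted = refl

admissible⇒sorted : ∀ D i j → T (admissible D i j) → Linked _≤_ j
admissible⇒sorted D i [] _ = []
admissible⇒sorted D i (a ∷ []) _ = [-]
admissible⇒sorted D i (a ∷ b ∷ r) adm =
  step-≤ (any (λ t → t ≡ᵇ i) D) (proj₁ adm′) ∷ admissible⇒sorted D (suc i) (b ∷ r) (proj₂ adm′)
  where
  adm′ = Equivalence.to BoolP.T-∧ adm
  step-≤ : ∀ c → T (if c then a <ᵇ b else a ≤ᵇ b) → a ≤ b
  step-≤ true = ℕP.<⇒≤ ∘ ℕP.<ᵇ⇒< a b
  step-≤ false = ℕP.≤ᵇ⇒≤ a b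

module _ {A : Set} where

  filterᵇ-cong-All : ∀ {p q : A → Bool} {xs} → All (λ j → p j ≡ q j) xs → filterᵇ p xs ≡ filterᵇ q xs
  filterᵇ-cong-All [] = refl
  filterᵇ-cong-All {p} {q} {j ∷ xs} (e ∷ es) with p j | q j
  filterᵇ-cong-All (refl ∷ es) | true | true = cong (_ ∷_) (filterᵇ-cong-All es)
  filterᵇ-cong-All (refl ∷ es) | false | false = filterᵇ-cong-All es

  length-filterᵇ-const-∧ : ∀ c (q : A → Bool) xs →
    length (filterᵇ (λ j → c ∧ q j) xs) ≡ (if c then length (filterᵇ q xs) else 0)
  length-filterᵇ-const-∧ true q xs = refl
  length-filterᵇ-const-∧ false q xs = cong length (ListP.filter-none (T? ∘ (λ _ → false)) (universal (λ _ ()) xs))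

  length-filterᵇ-map : ∀ {B : Set} (q : A → Bool) (h : B → A) xs →
    length (filterᵇ q (map h xs)) ≡ length (filterᵇ (q ∘ h) xs)
  length-filterᵇ-map q h [] = refl
  length-filterᵇ-map q h (j ∷ xs) with q (h j)
  ... | true = cong suc (length-filterᵇ-map q h xs)
  ... | false = length-filterᵇ-map q h xs

  length-filterᵇ-concatMap : ∀ {B : Set} (q : A → Bool) (g : B → List A) xs →
    length (filterᵇ q (concatMap g xs)) ≡ sum (map (λ b → length (filterᵇ q (g b))) xs)
  length-filterᵇ-concatMap q g [] = refl
  length-filterᵇ-concatMap q g (b ∷ bs) rewrite ListP.filter-++ (T? ∘ q) (g b) (concatMap g bs)
    | ListP.length-++ (filterᵇ q (g b)) {filterᵇ q (concatMap g bs)} | length-filterᵇ-concatMap q g bs = refl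

sum-map-zero : ∀ {A : Set} {f : A → ℕ} {xs} → All (λ a → f a ≡ 0) xs → sum (map f xs) ≡ 0
sum-map-zero [] = refl
sum-map-zero (e ∷ es) rewrite e | sum-map-zero es = refl

sum-applyUpTo-delta : ∀ (f g : ℕ → ℕ) K i₀ L → (∀ i → f (g i) ≡ (if i ≡ᵇ i₀ then K else 0)) → i₀ < L →
  sum (map f (applyUpTo g L)) ≡ K
sum-applyUpTo-delta f g K zero (suc L) h _ rewrite h 0 | sum-map-zero {f = f} (AllP.applyUpTo⁺₂ (g ∘ suc) L (h ∘ suc)) = ℕP.+-identityʳ K
sum-applyUpTo-delta f g K (suc i₀) (suc L) h (s≤s i₀<L) rewrite h 0 = sum-applyUpTo-delta f (g ∘ suc) K i₀ L (h ∘ suc) i₀<L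

seqs-positive : ∀ L d → All (All (0 <_)) (seqs L d)
seqs-positive L zero = [] ∷ []
seqs-positive L (suc d) = AllP.concat⁺ (AllP.map⁺ (universal (λ i → AllP.map⁺ (All.map (s≤s z≤n ∷_) (seqs-positive L d))) (upTo L)))

count-seqs : ∀ L d s → All (λ a → 0 < a × a ≤ L) s →
  length (filterᵇ (_==ᴸ s) (seqs L d)) ≡ (if length s ≡ᵇ d then 1 else 0)
count-seqs L zero [] _ = refl
count-seqs L zero (_ ∷ _) _ = refl
count-seqs L (suc d) [] _ = trans (length-filterᵇ-concatMap (_==ᴸ []) (λ i → map (suc i ∷_) (seqs L d)) (upTo L))
  (sum-map-zero (universal (λ i → trans (length-filterᵇ-map (_==ᴸ []) (suc i ∷_) (seqs L d))
    (cong length (ListP.filter-none (T? ∘ (λ _ → false)) (universal (λ _ ()) (seqs L d))))) (upTo L)))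
count-seqs L (suc d) (suc i₀ ∷ s) ((_ , i₀<L) ∷ bounded) = begin
  length (filterᵇ (_==ᴸ (suc i₀ ∷ s)) (concatMap (λ i → map (suc i ∷_) (seqs L d)) (upTo L)))
    ≡⟨ length-filterᵇ-concatMap (_==ᴸ (suc i₀ ∷ s)) (λ i → map (suc i ∷_) (seqs L d)) (upTo L) ⟩
  sum (map branch (upTo L))
    ≡⟨ sum-applyUpTo-delta branch (λ i → i) (count s) i₀ L branch-delta i₀<L ⟩
  count s
    ≡⟨ count-seqs L d s bounded ⟩
  (if length s ≡ᵇ d then 1 else 0) ∎
  where
  open ≡-Reasoning
  count : List ℕ → ℕ
  count s = length (filterᵇ (_==ᴸ s) (seqs L d))
  branch : ℕ → ℕ
  branch i = length (filterᵇ (_==ᴸ (suc i₀ ∷ s)) (map (suc i ∷_) (seqs L d)))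
  branch-delta : ∀ i → branch i ≡ (if i ≡ᵇ i₀ then count s else 0)
  branch-delta i = begin
    branch i
      ≡⟨ length-filterᵇ-map (_==ᴸ (suc i₀ ∷ s)) (suc i ∷_) (seqs L d) ⟩
    length (filterᵇ (λ y → (suc i ∷ y) ==ᴸ (suc i₀ ∷ s)) (seqs L d))
      ≡⟨ cong length (filterᵇ-cong-All (universal (λ y → ==ᴸ-∷ (suc i) (suc i₀) y s) (seqs L d))) ⟩
    length (filterᵇ (λ y → (i ≡ᵇ i₀) ∧ (y ==ᴸ s)) (seqs L d))
      ≡⟨ length-filterᵇ-const-∧ (i ≡ᵇ i₀) (_==ᴸ s) (seqs L d) ⟩
    (if i ≡ᵇ i₀ then count s else 0) ∎

∧-==ᴸ-unique : ∀ (p : List ℕ → Bool) {j s} → (T (p j) → j ≡ s) → p j ≡ p s ∧ (j ==ᴸ s)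
∧-==ᴸ-unique p {j} {s} unique with p j in pj
... | true rewrite sym (unique tt) | pj | ==ᴸ-refl j = refl
... | false with j ==ᴸ s in js
...   | false = sym (BoolP.∧-zeroʳ (p s))
...   | true with toWitness (subst T (sym js) tt)
...     | refl = trans (sym pj) (sym (BoolP.∧-identityʳ (p j)))

isFMonomial : List ℕ → List ℕ → Bool
isFMonomial α t = admissible (Dset α) 1 (indices t) ∧ (sum t ≡ᵇ sum α)

-- Of the index sequences enumerated by F, only indices t gives the monomial t, so the count is 0 or 1.
F-⟦⟧ : ∀ α t → F α ⟦ t ⟧ ≡ ℕtoℚ (if isFMonomial α t then 1 else 0)
F-⟦⟧ α t = cong ℕtoℚ (begin
  length (filterᵇ p js)
    ≡⟨ cong length (filterᵇ-cong-All (All.map (λ {j} pos → ∧-==ᴸ-unique p (unique j pos)) (seqs-positive (length u) (sum α)))) ⟩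
  length (filterᵇ (λ j → p s ∧ (j ==ᴸ s)) js)
    ≡⟨ length-filterᵇ-const-∧ (p s) (_==ᴸ s) js ⟩
  (if p s then length (filterᵇ (_==ᴸ s) js) else 0)
    ≡⟨ cong₂ (λ b n → if b then n else 0) p-s (count-seqs (length u) (sum α) s (indices-bounded u)) ⟩
  (if admissible D 1 s then (if length s ≡ᵇ sum α then 1 else 0) else 0)
    ≡⟨ if-∧ (admissible D 1 s) ⟩
  (if admissible D 1 s ∧ (length s ≡ᵇ sum α) then 1 else 0)
    ≡⟨ cong (λ n → if admissible D 1 s ∧ (n ≡ᵇ sum α) then 1 else 0)
            (trans (length-indices u) (trans (sum-trim (trim t)) (sum-trim t))) ⟩
  (if admissible D 1 s ∧ (sum t ≡ᵇ sum α) then 1 else 0)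
    ≡⟨ cong (λ s → if admissible D 1 s ∧ (sum t ≡ᵇ sum α) then 1 else 0)
            (trans (indices-trim (trim t)) (indices-trim t)) ⟩
  (if isFMonomial α t then 1 else 0) ∎)
  where
  open ≡-Reasoning
  D = Dset α
  u = trim (trim t)
  s = indices u
  js = seqs (length u) (sum α)
  p : List ℕ → Bool
  p j = admissible D 1 j ∧ (trim (expo j) ==ᴸ u)
  p-s : p s ≡ admissible D 1 s
  p-s rewrite expo-indices u | trim-idem u | trim-idem (trim t) | ==ᴸ-refl u = BoolP.∧-identityʳ _
  unique : ∀ j → All (0 <_) j → T (p j) → j ≡ s
  unique j pos pj = begin
    j               ≡⟨ sym (indices-expo j pos (admissible⇒sorted D 1 j (proj₁ pj′))) ⟩
    indices (expo j) ≡⟨ cong indices (trans (sym (trim-expo j pos)) (toWitness (proj₂ pj′))) ⟩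
    s               ∎
    where pj′ = Equivalence.to BoolP.T-∧ pj
  if-∧ : ∀ c {b} → (if c then (if b then 1 else 0) else 0) ≡ (if c ∧ b then 1 else 0)
  if-∧ true = refl
  if-∧ false = refl

-- F_α at the first variable

any-map : ∀ (p : ℕ → Bool) (f : ℕ → ℕ) xs → any p (map f xs) ≡ any (p ∘ f) xs
any-map p f xs = cong or (sym (ListP.map-∘ xs))

admissible-map-suc : ∀ D i j → admissible D i (map suc j) ≡ admissible D i j
admissible-map-suc D i [] = refl
admissible-map-suc D i (a ∷ []) = refl
admissible-map-suc D i (a ∷ b ∷ r) =
  cong₂ _∧_ (cong (λ v → if any (λ t → t ≡ᵇ i) D then a <ᵇ b else v) (<ᵇ-suc a b)) (admissible-map-suc D (suc i) (b ∷ r))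
  where
  <ᵇ-suc : ∀ a b → (a <ᵇ suc b) ≡ (a ≤ᵇ b)
  <ᵇ-suc zero b = refl
  <ᵇ-suc (suc a) b = refl

admissible-suc : ∀ D i j → admissible (map suc D) (suc i) j ≡ admissible D i j
admissible-suc D i [] = refl
admissible-suc D i (a ∷ []) = refl
admissible-suc D i (a ∷ b ∷ r) =
  cong₂ _∧_ (cong (λ c → if c then a <ᵇ b else a ≤ᵇ b) (any-map (λ t → t ≡ᵇ suc i) suc D)) (admissible-suc D (suc i) (b ∷ r))

admissible-drop-1 : ∀ D i j → admissible (1 ∷ D) (suc (suc i)) j ≡ admissible D (suc (suc i)) j
admissible-drop-1 D i [] = refl
admissible-drop-1 D i (a ∷ []) = refl
admissible-drop-1 D i (a ∷ b ∷ r) rewrite admissible-drop-1 D (suc i) (b ∷ r) = refl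

Dset-2+ : ∀ a β → Dset (suc (suc a) ∷ β) ≡ map suc (Dset (suc a ∷ β))
Dset-2+ a [] = refl
Dset-2+ a (b ∷ β) = cong (suc (suc a) ∷_) (ListP.map-∘ (Dset (b ∷ β)))

0∉Dset : ∀ a β → any (λ t → t ≡ᵇ 0) (Dset (suc a ∷ β)) ≡ false
0∉Dset a [] = refl
0∉Dset a (b ∷ β) rewrite any-map (λ t → t ≡ᵇ 0) (suc a +_) (Dset (b ∷ β)) = any-false (Dset (b ∷ β))
  where
  any-false : ∀ (xs : List ℕ) → any (λ _ → false) xs ≡ false
  any-false [] = refl
  any-false (_ ∷ xs) = any-false xs

isFMonomial-0∷ : ∀ α l → isFMonomial α (0 ∷ l) ≡ isFMonomial α l
isFMonomial-0∷ α l rewrite admissible-map-suc (Dset α) 1 (indices l) = refl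

admissible-2+-1∷ : ∀ a β j → All (0 <_) j → admissible (Dset (suc (suc a) ∷ β)) 1 (1 ∷ j) ≡ admissible (Dset (suc a ∷ β)) 1 j
admissible-2+-1∷ a β [] _ = refl
admissible-2+-1∷ a β (zero ∷ _) (() ∷ _)
admissible-2+-1∷ a β (suc c ∷ j) _ rewrite Dset-2+ a β | any-map (λ t → t ≡ᵇ 1) suc (Dset (suc a ∷ β)) | 0∉Dset a β
  = admissible-suc (Dset (suc a ∷ β)) 1 (suc c ∷ j)

isFMonomial-2+-suc∷ : ∀ a β k l → isFMonomial (suc (suc a) ∷ β) (suc k ∷ l) ≡ isFMonomial (suc a ∷ β) (k ∷ l)
isFMonomial-2+-suc∷ a β k l rewrite admissible-2+-1∷ a β (indices (k ∷ l)) (indices-positive (k ∷ l)) = refl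

admissible-1∷-1∷ : ∀ β j → All (0 <_) j → admissible (Dset (1 ∷ β)) 1 (1 ∷ map suc j) ≡ admissible (Dset β) 1 j
admissible-1∷-1∷ β [] _ = refl
admissible-1∷-1∷ β (zero ∷ _) (() ∷ _)
admissible-1∷-1∷ [] (suc c ∷ j) _ =
  trans (admissible-suc [] 1 (map suc (suc c ∷ j))) (admissible-map-suc [] 1 (suc c ∷ j))
admissible-1∷-1∷ (b ∷ β) (suc c ∷ j) _ =
  trans (admissible-drop-1 (map suc (Dset (b ∷ β))) 0 (map suc (suc c ∷ j)))
  (trans (admissible-suc (Dset (b ∷ β)) 1 (map suc (suc c ∷ j))) (admissible-map-suc (Dset (b ∷ β)) 1 (suc c ∷ j)))

isFMonomial-1∷-1∷ : ∀ β l → isFMonomial (1 ∷ β) (1 ∷ l) ≡ isFMonomial β l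
isFMonomial-1∷-1∷ β l rewrite admissible-1∷-1∷ β (indices l) (indices-positive l) = refl

isFMonomial-1∷-2+∷ : ∀ β k l → isFMonomial (1 ∷ β) (suc (suc k) ∷ l) ≡ false
isFMonomial-1∷-2+∷ [] k l = BoolP.∧-zeroʳ (admissible [] 1 (indices (suc (suc k) ∷ l)))
isFMonomial-1∷-2+∷ (b ∷ β) k l = refl

isFMonomial-[]-suc∷ : ∀ k l → isFMonomial [] (suc k ∷ l) ≡ false
isFMonomial-[]-suc∷ k l = BoolP.∧-zeroʳ (admissible [] 1 (indices (suc k ∷ l)))

F-⟦⟧-cong : ∀ {α β t u} → isFMonomial α t ≡ isFMonomial β u → F α ⟦ t ⟧ ≡ F β ⟦ u ⟧
F-⟦⟧-cong {α} {β} {t} {u} eq = trans (F-⟦⟧ α t) (trans (cong (λ b → ℕtoℚ (if b then 1 else 0)) eq) (sym (F-⟦⟧ β u)))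

F-⟦⟧-zero : ∀ {α t} → isFMonomial α t ≡ false → F α ⟦ t ⟧ ≡ 0ℚ
F-⟦⟧-zero {α} {t} eq = trans (F-⟦⟧ α t) (cong (λ b → ℕtoℚ (if b then 1 else 0)) eq)

F-⟦0∷⟧ : ∀ α l → F α ⟦ 0 ∷ l ⟧ ≡ F α ⟦ l ⟧
F-⟦0∷⟧ α l = F-⟦⟧-cong {α} {α} {0 ∷ l} {l} (isFMonomial-0∷ α l)

-- Unfolding G

splitLast-just⇒ : ∀ ν {γ s} → splitLast ν ≡ just (γ , s) → ν ≡ γ ++ 0 ∷ s
splitLast-just⇒ [] ()
splitLast-just⇒ (a ∷ ν) e with splitLast ν in eq
splitLast-just⇒ (a ∷ ν) refl | just _ = cong (a ∷_) (splitLast-just⇒ ν eq)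
splitLast-just⇒ (zero ∷ ν) refl | nothing = refl
splitLast-just⇒ (suc a ∷ ν) () | nothing

splitLast-∷-just : ∀ a ν {γ s} → splitLast ν ≡ just (γ , s) → splitLast (a ∷ ν) ≡ just (a ∷ γ , s)
splitLast-∷-just a ν e rewrite e = refl

splitLast-0∷-nothing : ∀ ν → splitLast ν ≡ nothing → splitLast (0 ∷ ν) ≡ just ([] , ν)
splitLast-0∷-nothing ν e rewrite e = refl

splitLast-suc∷-nothing : ∀ a ν → splitLast ν ≡ nothing → splitLast (suc a ∷ ν) ≡ nothing
splitLast-suc∷-nothing a ν e rewrite e = refl

splitLast-tail-nothing : ∀ a ν → splitLast (a ∷ ν) ≡ nothing → splitLast ν ≡ nothing
splitLast-tail-nothing a ν e with splitLast ν
splitLast-tail-nothing a ν () | just _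
... | nothing = refl

splitLast-0∷≢nothing : ∀ ν → splitLast (0 ∷ ν) ≢ nothing
splitLast-0∷≢nothing ν with splitLast ν
... | just _ = λ ()
... | nothing = λ ()

length-split : ∀ ν {γ b β} → splitLast ν ≡ just (γ , b ∷ β) → ∀ c → length ν ≡ suc (length (γ ++ c ∷ β))
length-split ν {γ} {b} {β} e c = begin
  length ν                   ≡⟨ cong length (splitLast-just⇒ ν e) ⟩
  length (γ ++ 0 ∷ b ∷ β)    ≡⟨ ListP.length-++-sucʳ γ 0 (b ∷ β) ⟩
  suc (length (γ ++ b ∷ β))  ≡⟨ cong suc (ListP.length-++-sucʳ γ b β) ⟩
  suc (suc (length (γ ++ β))) ≡⟨ cong suc (sym (ListP.length-++-sucʳ γ c β)) ⟩
  suc (length (γ ++ c ∷ β))  ∎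
  where open ≡-Reasoning

splitLast-trimmed : ∀ ν {γ} → trim ν ≡ ν → splitLast ν ≢ just (γ , [])
splitLast-trimmed ν {γ} tν e = ℕP.<-irrefl refl (ℕP.≤-trans (s≤s (length-trim γ)) (ℕP.≤-reflexive (sym (begin
  length (trim γ)             ≡⟨ cong length (sym (trim-∷ʳ-0 γ)) ⟩
  length (trim (γ ++ [ 0 ]))  ≡⟨ cong (length ∘ trim) (sym ν≡) ⟩
  length (trim ν)             ≡⟨ cong length tν ⟩
  length ν                    ≡⟨ cong length ν≡ ⟩
  length (γ ++ [ 0 ])         ≡⟨ ListP.length-++-sucʳ γ 0 [] ⟩
  suc (length (γ ++ []))      ≡⟨ cong (suc ∘ length) (ListP.++-identityʳ γ) ⟩
  suc (length γ)              ∎))))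
  where
  open ≡-Reasoning
  ν≡ = splitLast-just⇒ ν e

Gf-fuel : ∀ f f′ ν → length ν ≤ f → length ν ≤ f′ → Gf f ν ≡ Gf f′ ν
Gf-fuel zero zero ν _ _ = refl
Gf-fuel zero (suc f′) [] _ _ = refl
Gf-fuel (suc f) zero [] _ _ = refl
Gf-fuel (suc f) (suc f′) ν p q with splitLast ν in eq
... | nothing = refl
... | just (γ , []) = Gf-fuel f f′ (trim γ) (bound p) (bound q)
  where
  bound : ∀ {g} → length ν ≤ suc g → length (trim γ) ≤ g
  bound r = ℕP.≤-trans (length-trim γ) (ℕP.≤-trans (ℕP.≤-reflexive (cong length (sym (ListP.++-identityʳ γ))))
    (ℕ.s≤s⁻¹ (subst (_≤ _) (trans (cong length (splitLast-just⇒ ν eq)) (ListP.length-++-sucʳ γ 0 [])) r)))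
... | just (γ , a ∷ β) = cong₂ (λ P Q → P -S x (suc (length γ)) *S Q)
      (Gf-fuel f f′ (trim (γ ++ a ∷ β)) (bound a p) (bound a q))
      (Gf-fuel f f′ (trim (γ ++ (a ∸ 1) ∷ β)) (bound (a ∸ 1) p) (bound (a ∸ 1) q))
  where
  bound : ∀ c {g} → length ν ≤ suc g → length (trim (γ ++ c ∷ β)) ≤ g
  bound c r = ℕP.≤-trans (length-trim (γ ++ c ∷ β)) (ℕ.s≤s⁻¹ (subst (_≤ _) (length-split ν eq c) r))

G-trim : ∀ ρ → G (trim ρ) ≡ G ρ
G-trim ρ = cong (λ l → Gf (length l) l) (trim-idem ρ)

G-∷-trim : ∀ a ρ → G (a ∷ trim ρ) ≡ G (a ∷ ρ)
G-∷-trim a ρ = cong (λ l → Gf (length l) l) (trim-∷-trim a ρ)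

G-zeroFree : ∀ ν → trim ν ≡ ν → splitLast ν ≡ nothing → G ν ≡ F ν
G-zeroFree ν tν e rewrite tν | e = refl

G-step : ∀ ν {γ a β} → trim ν ≡ ν → splitLast ν ≡ just (γ , a ∷ β) →
  G ν ≡ G (γ ++ a ∷ β) -S x (suc (length γ)) *S G (γ ++ (a ∸ 1) ∷ β)
G-step ν {γ} {a} {β} tν e rewrite tν | length-split ν e a | e =
  cong₂ (λ P Q → P -S x (suc (length γ)) *S Q) (fuel a) (fuel (a ∸ 1))
  where
  fuel : ∀ c → Gf (length (γ ++ a ∷ β)) (trim (γ ++ c ∷ β)) ≡ G (γ ++ c ∷ β)
  fuel c = Gf-fuel (length (γ ++ a ∷ β)) (length (trim (γ ++ c ∷ β))) (trim (γ ++ c ∷ β))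
    (ℕP.≤-trans (length-trim (γ ++ c ∷ β))
      (ℕP.≤-reflexive (ℕP.suc-injective (trans (sym (length-split ν e c)) (length-split ν e a)))))
    ℕP.≤-refl

G-step-⟦⟧ : ∀ ν {γ a β} → trim ν ≡ ν → splitLast ν ≡ just (γ , a ∷ β) → ∀ m →
  G ν ⟦ m ⟧ ≡ G (γ ++ a ∷ β) ⟦ m ⟧ +ℚ -ℚ ((x (suc (length γ)) *S G (γ ++ (a ∸ 1) ∷ β)) ⟦ m ⟧)
G-step-⟦⟧ ν {γ} {a} {β} tν e m =
  trans (≡⇒≈ (G-step ν tν e) m) (-S-⟦⟧ (G (γ ++ a ∷ β)) (x (suc (length γ)) *S G (γ ++ (a ∸ 1) ∷ β)) m)

G-∷-step-⟦∷⟧ : ∀ c ν {γ a β} → trim ν ≡ ν → splitLast ν ≡ just (γ , a ∷ β) → ∀ e m →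
  G (c ∷ ν) ⟦ e ∷ m ⟧ ≡
    G (c ∷ γ ++ a ∷ β) ⟦ e ∷ m ⟧ +ℚ -ℚ ((x (suc (length γ)) *S coeff₁ e (G (c ∷ γ ++ (a ∸ 1) ∷ β))) ⟦ m ⟧)
G-∷-step-⟦∷⟧ c (y ∷ ys) {γ} {a} {β} tν eq e m = trans
  (G-step-⟦⟧ (c ∷ y ∷ ys) (trim-∷-trimmed c y ys tν) (splitLast-∷-just c (y ∷ ys) eq) (e ∷ m))
  (cong (λ q → G (c ∷ γ ++ a ∷ β) ⟦ e ∷ m ⟧ +ℚ -ℚ q) (x-2+*-⟦∷⟧ (length γ) (G (c ∷ γ ++ (a ∸ 1) ∷ β)) e m))

trimmed-induction : (P : List ℕ → Set) → (∀ ρ → P (trim ρ) → P ρ) →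
  (∀ ν → trim ν ≡ ν → (∀ σ → length σ < length ν → P σ) → P ν) → ∀ ρ → P ρ
trimmed-induction P P-trim step ρ = go ρ (<-wellFounded (length ρ))
  where
  go : ∀ ρ → Acc _<_ (length ρ) → P ρ
  go ρ (acc rs) = P-trim ρ (step (trim ρ) (trim-idem ρ) (λ σ σ< → go σ (rs (ℕP.<-≤-trans σ< (length-trim ρ)))))

-- Coefficientwise form of P = Q(x₂, x₃, …).
_IsShiftOf_ : Series → Series → Set
P IsShiftOf Q = (∀ m → P ⟦ 0 ∷ m ⟧ ≡ Q ⟦ m ⟧) × NoX1 P

F-suc∷-⟦suc∷⟧ : ∀ a β → trim β ≡ β → splitLast β ≡ nothing → G (0 ∷ β) IsShiftOf G β →
  ∀ k m → F (suc a ∷ β) ⟦ suc k ∷ m ⟧ ≡ G (a ∷ β) ⟦ k ∷ m ⟧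
F-suc∷-⟦suc∷⟧ (suc a) β tβ eβ _ k m = trans
  (F-⟦⟧-cong {suc (suc a) ∷ β} {suc a ∷ β} {suc k ∷ m} {k ∷ m} (isFMonomial-2+-suc∷ a β k m))
  (sym (≡⇒≈ (G-zeroFree (suc a ∷ β) (trim-suc-∷-trimmed a β tβ) (splitLast-suc∷-nothing a β eβ)) (k ∷ m)))
F-suc∷-⟦suc∷⟧ zero β tβ eβ (G0β-0∷ , _) zero m = trans
  (F-⟦⟧-cong {1 ∷ β} {β} {1 ∷ m} {m} (isFMonomial-1∷-1∷ β m))
  (sym (trans (G0β-0∷ m) (≡⇒≈ (G-zeroFree β tβ eβ) m)))
F-suc∷-⟦suc∷⟧ zero β tβ eβ (_ , G0β-noX1) (suc k) m =
  trans (F-⟦⟧-zero {1 ∷ β} {suc (suc k) ∷ m} (isFMonomial-1∷-2+∷ β k m)) (sym (G0β-noX1 k m))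

G-0∷-IsShiftOf-zeroFree : ∀ a ys → trim (suc a ∷ ys) ≡ suc a ∷ ys → splitLast (suc a ∷ ys) ≡ nothing →
  G (0 ∷ ys) IsShiftOf G ys → G (0 ∷ suc a ∷ ys) IsShiftOf G (suc a ∷ ys)
G-0∷-IsShiftOf-zeroFree a ys tν eq ih = at-0 , at-suc
  where
  ν = suc a ∷ ys
  unfold : ∀ m → G (0 ∷ ν) ⟦ m ⟧ ≡ F ν ⟦ m ⟧ +ℚ -ℚ ((x 1 *S G (a ∷ ys)) ⟦ m ⟧)
  unfold m = trans (G-step-⟦⟧ (0 ∷ ν) (trim-∷-trimmed 0 (suc a) ys tν) (splitLast-0∷-nothing ν eq) m)
    (cong (_+ℚ -ℚ ((x 1 *S G (a ∷ ys)) ⟦ m ⟧)) (≡⇒≈ (G-zeroFree ν tν eq) m))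
  at-0 : ∀ m → G (0 ∷ ν) ⟦ 0 ∷ m ⟧ ≡ G ν ⟦ m ⟧
  at-0 m = begin
    G (0 ∷ ν) ⟦ 0 ∷ m ⟧                                ≡⟨ unfold (0 ∷ m) ⟩
    F ν ⟦ 0 ∷ m ⟧ +ℚ -ℚ ((x 1 *S G (a ∷ ys)) ⟦ 0 ∷ m ⟧)
      ≡⟨ cong₂ (λ p q → p +ℚ -ℚ q) (F-⟦0∷⟧ ν m) (x₁*-⟦0∷⟧ (G (a ∷ ys)) m) ⟩
    F ν ⟦ m ⟧ +ℚ 0ℚ                                     ≡⟨ ℚP.+-identityʳ _ ⟩
    F ν ⟦ m ⟧                                           ≡⟨ ≡⇒≈ (G-zeroFree ν tν eq) m ⟨
    G ν ⟦ m ⟧                                           ∎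
    where open ≡-Reasoning
  at-suc : NoX1 (G (0 ∷ ν))
  at-suc k m = begin
    G (0 ∷ ν) ⟦ suc k ∷ m ⟧                                     ≡⟨ unfold (suc k ∷ m) ⟩
    F ν ⟦ suc k ∷ m ⟧ +ℚ -ℚ ((x 1 *S G (a ∷ ys)) ⟦ suc k ∷ m ⟧)
      ≡⟨ cong₂ (λ p q → p +ℚ -ℚ q)
           (F-suc∷-⟦suc∷⟧ a ys (trimmed-tail (suc a) ys tν) (splitLast-tail-nothing (suc a) ys eq) ih k m)
           (x₁*-⟦suc∷⟧ (G (a ∷ ys)) k m) ⟩
    G (a ∷ ys) ⟦ k ∷ m ⟧ +ℚ -ℚ (G (a ∷ ys) ⟦ k ∷ m ⟧)            ≡⟨ ℚP.+-inverseʳ (G (a ∷ ys) ⟦ k ∷ m ⟧) ⟩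
    0ℚ                                                          ∎
    where open ≡-Reasoning

G-0∷-IsShiftOf-step : ∀ ν {γ b β} → trim ν ≡ ν → splitLast ν ≡ just (γ , b ∷ β) →
  G (0 ∷ γ ++ b ∷ β) IsShiftOf G (γ ++ b ∷ β) → G (0 ∷ γ ++ (b ∸ 1) ∷ β) IsShiftOf G (γ ++ (b ∸ 1) ∷ β) →
  G (0 ∷ ν) IsShiftOf G ν
G-0∷-IsShiftOf-step ν {γ} {b} {β} tν eq (ih₁-0 , ih₁-suc) (ih₂-0 , ih₂-suc) = at-0 , at-suc
  where
  ρ₁ = γ ++ b ∷ β
  ρ₂ = γ ++ (b ∸ 1) ∷ β
  xₖ = x (suc (length γ))
  at-0 : ∀ m → G (0 ∷ ν) ⟦ 0 ∷ m ⟧ ≡ G ν ⟦ m ⟧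
  at-0 m = begin
    G (0 ∷ ν) ⟦ 0 ∷ m ⟧                                        ≡⟨ G-∷-step-⟦∷⟧ 0 ν tν eq 0 m ⟩
    G (0 ∷ ρ₁) ⟦ 0 ∷ m ⟧ +ℚ -ℚ ((xₖ *S coeff₁ 0 (G (0 ∷ ρ₂))) ⟦ m ⟧)
      ≡⟨ cong₂ (λ p q → p +ℚ -ℚ q) (ih₁-0 m)
           (*S-congʳ xₖ (coeff₁ 0 (G (0 ∷ ρ₂))) (G ρ₂) (λ l → trans (coeff₁-⟦⟧ 0 (G (0 ∷ ρ₂)) l) (ih₂-0 l)) m) ⟩
    G ρ₁ ⟦ m ⟧ +ℚ -ℚ ((xₖ *S G ρ₂) ⟦ m ⟧)                       ≡⟨ G-step-⟦⟧ ν tν eq m ⟨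
    G ν ⟦ m ⟧                                                  ∎
    where open ≡-Reasoning
  at-suc : NoX1 (G (0 ∷ ν))
  at-suc k m = begin
    G (0 ∷ ν) ⟦ suc k ∷ m ⟧                                    ≡⟨ G-∷-step-⟦∷⟧ 0 ν tν eq (suc k) m ⟩
    G (0 ∷ ρ₁) ⟦ suc k ∷ m ⟧ +ℚ -ℚ ((xₖ *S coeff₁ (suc k) (G (0 ∷ ρ₂))) ⟦ m ⟧)
      ≡⟨ cong₂ (λ p q → p +ℚ -ℚ q) (ih₁-suc k m)
           (*S-zeroʳ xₖ (coeff₁ (suc k) (G (0 ∷ ρ₂))) (λ l → trans (coeff₁-⟦⟧ (suc k) (G (0 ∷ ρ₂)) l) (ih₂-suc k l)) m) ⟩
    0ℚ +ℚ -ℚ 0ℚ                                                ≡⟨ ℚP.+-inverseʳ 0ℚ ⟩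
    0ℚ                                                         ∎
    where open ≡-Reasoning

G-0∷-IsShiftOf : ∀ ρ → G (0 ∷ ρ) IsShiftOf G ρ
G-0∷-IsShiftOf = trimmed-induction (λ ρ → G (0 ∷ ρ) IsShiftOf G ρ) retrim step
  where
  retrim : ∀ ρ → G (0 ∷ trim ρ) IsShiftOf G (trim ρ) → G (0 ∷ ρ) IsShiftOf G ρ
  retrim ρ rewrite G-∷-trim 0 ρ | G-trim ρ = λ h → h
  step : ∀ ν → trim ν ≡ ν → (∀ σ → length σ < length ν → G (0 ∷ σ) IsShiftOf G σ) → G (0 ∷ ν) IsShiftOf G ν
  step ν tν ih with splitLast ν in eq
  step [] _ _ | nothing = F-⟦0∷⟧ [] , λ k m → F-⟦⟧-zero {[]} {suc k ∷ m} (isFMonomial-[]-suc∷ k m)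
  step (zero ∷ ys) _ _ | nothing = ⊥-elim (splitLast-0∷≢nothing ys eq)
  step (suc a ∷ ys) tν ih | nothing = G-0∷-IsShiftOf-zeroFree a ys tν eq (ih ys ℕP.≤-refl)
  step ν tν ih | just (γ , []) = ⊥-elim (splitLast-trimmed ν tν eq)
  step ν tν ih | just (γ , b ∷ β) = G-0∷-IsShiftOf-step ν tν eq
    (ih (γ ++ b ∷ β) (ℕP.≤-reflexive (sym (length-split ν eq b))))
    (ih (γ ++ (b ∸ 1) ∷ β) (ℕP.≤-reflexive (sym (length-split ν eq (b ∸ 1)))))

G-suc∷-⟦suc∷⟧ : ∀ ρ b k m → G (suc b ∷ ρ) ⟦ suc k ∷ m ⟧ ≡ G (b ∷ ρ) ⟦ k ∷ m ⟧
G-suc∷-⟦suc∷⟧ = trimmed-induction Lowers retrim step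
  where
  Lowers : List ℕ → Set
  Lowers ρ = ∀ b k m → G (suc b ∷ ρ) ⟦ suc k ∷ m ⟧ ≡ G (b ∷ ρ) ⟦ k ∷ m ⟧
  retrim : ∀ ρ → Lowers (trim ρ) → Lowers ρ
  retrim ρ h b rewrite sym (G-∷-trim (suc b) ρ) | sym (G-∷-trim b ρ) = h b
  step : ∀ ν → trim ν ≡ ν → (∀ σ → length σ < length ν → Lowers σ) → Lowers ν
  step ν tν ih b k m with splitLast ν in eq
  ... | nothing = trans
    (≡⇒≈ (G-zeroFree (suc b ∷ ν) (trim-suc-∷-trimmed b ν tν) (splitLast-suc∷-nothing b ν eq)) (suc k ∷ m))
    (F-suc∷-⟦suc∷⟧ b ν tν eq (G-0∷-IsShiftOf ν) k m)
  ... | just (γ , []) = ⊥-elim (splitLast-trimmed ν tν eq)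
  ... | just (γ , a ∷ β) = begin
    G (suc b ∷ ν) ⟦ suc k ∷ m ⟧                                       ≡⟨ G-∷-step-⟦∷⟧ (suc b) ν tν eq (suc k) m ⟩
    G (suc b ∷ ρ₁) ⟦ suc k ∷ m ⟧ +ℚ -ℚ ((xₖ *S coeff₁ (suc k) (G (suc b ∷ ρ₂))) ⟦ m ⟧)
      ≡⟨ cong₂ (λ p q → p +ℚ -ℚ q) (ih₁ b k m) (*S-congʳ xₖ (coeff₁ (suc k) (G (suc b ∷ ρ₂))) (coeff₁ k (G (b ∷ ρ₂))) ih₂′ m) ⟩
    G (b ∷ ρ₁) ⟦ k ∷ m ⟧ +ℚ -ℚ ((xₖ *S coeff₁ k (G (b ∷ ρ₂))) ⟦ m ⟧)   ≡⟨ G-∷-step-⟦∷⟧ b ν tν eq k m ⟨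
    G (b ∷ ν) ⟦ k ∷ m ⟧                                               ∎
    where
    open ≡-Reasoning
    ρ₁ = γ ++ a ∷ β
    ρ₂ = γ ++ (a ∸ 1) ∷ β
    ih₁ = ih ρ₁ (ℕP.≤-reflexive (sym (length-split ν eq a)))
    ih₂ = ih ρ₂ (ℕP.≤-reflexive (sym (length-split ν eq (a ∸ 1))))
    ih₂′ : coeff₁ (suc k) (G (suc b ∷ ρ₂)) ≈ coeff₁ k (G (b ∷ ρ₂))
    ih₂′ l = trans (coeff₁-⟦⟧ (suc k) (G (suc b ∷ ρ₂)) l) (trans (ih₂ b k l) (sym (coeff₁-⟦⟧ k (G (b ∷ ρ₂)) l)))
    xₖ = x (suc (length γ))

-- Setting x₁ = 0

shift-⟦0∷⟧ : ∀ P m → shift P ⟦ 0 ∷ m ⟧ ≡ P ⟦ m ⟧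
shift-⟦0∷⟧ P m rewrite trim-idem (0 ∷ m) with trim m in eq
... | [] = refl
... | _ ∷ _ = cong (coeff P) (trans (cong trim (sym eq)) (trans (trim-idem m) eq))

shift-⟦suc∷⟧ : ∀ P k m → shift P ⟦ suc k ∷ m ⟧ ≡ 0ℚ
shift-⟦suc∷⟧ P k m rewrite trim-idem (suc k ∷ m) | trimCons-suc k (trim m) = refl

IsShiftOf⇒≈shift : ∀ {P Q} → P IsShiftOf Q → P ≈ shift Q
IsShiftOf⇒≈shift (at-0 , _) [] = at-0 []
IsShiftOf⇒≈shift {Q = Q} (at-0 , _) (zero ∷ m) = trans (at-0 m) (sym (shift-⟦0∷⟧ Q m))
IsShiftOf⇒≈shift {Q = Q} (_ , noX1) (suc k ∷ m) = trans (noX1 k m) (sym (shift-⟦suc∷⟧ Q k m))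

x₁-decomposition : ∀ P Q → (∀ k m → P ⟦ suc k ∷ m ⟧ ≡ Q ⟦ k ∷ m ⟧) → P ≈ x 1 *S Q +S shift (coeff₁ 0 P)
x₁-decomposition P Q lowers m = sym (trans (+S-⟦⟧ (x 1 *S Q) (shift (coeff₁ 0 P)) m) (split m))
  where
  split : ∀ m → (x 1 *S Q) ⟦ m ⟧ +ℚ shift (coeff₁ 0 P) ⟦ m ⟧ ≡ P ⟦ m ⟧
  split [] = trans (cong (_+ℚ P ⟦ [] ⟧) (x*-⟦const⟧ 0 Q [] refl)) (ℚP.+-identityˡ _)
  split (zero ∷ m) =
    trans (cong₂ _+ℚ_ (x₁*-⟦0∷⟧ Q m) (trans (shift-⟦0∷⟧ (coeff₁ 0 P) m) (coeff₁-⟦⟧ 0 P m))) (ℚP.+-identityˡ _)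
  split (suc k ∷ m) =
    trans (cong₂ _+ℚ_ (trans (x₁*-⟦suc∷⟧ Q k m) (sym (lowers k m))) (shift-⟦suc∷⟧ (coeff₁ 0 P) k m)) (ℚP.+-identityʳ _)

lincomb-⟦0∷⟧ : ∀ cs m → lincomb cs ⟦ 0 ∷ m ⟧ ≡ lincomb (map (λ (c , α) → coeff₁ 0 c , α) cs) ⟦ m ⟧
lincomb-⟦0∷⟧ [] m = refl
lincomb-⟦0∷⟧ ((c , α) ∷ cs) m = begin
  (c *S F α +S lincomb cs) ⟦ 0 ∷ m ⟧                  ≡⟨ +S-⟦⟧ (c *S F α) (lincomb cs) (0 ∷ m) ⟩
  (c *S F α) ⟦ 0 ∷ m ⟧ +ℚ lincomb cs ⟦ 0 ∷ m ⟧
    ≡⟨ cong₂ _+ℚ_ (trans (*S-⟦0∷⟧ c (F α) m) (*S-congʳ (coeff₁ 0 c) (coeff₁ 0 (F α)) (F α) F-coeff₁-0 m))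
                  (lincomb-⟦0∷⟧ cs m) ⟩
  (coeff₁ 0 c *S F α) ⟦ m ⟧ +ℚ lincomb cs′ ⟦ m ⟧       ≡⟨ +S-⟦⟧ (coeff₁ 0 c *S F α) (lincomb cs′) m ⟨
  (coeff₁ 0 c *S F α +S lincomb cs′) ⟦ m ⟧             ∎
  where
  open ≡-Reasoning
  cs′ = map (λ (c , α) → coeff₁ 0 c , α) cs
  F-coeff₁-0 : coeff₁ 0 (F α) ≈ F α
  F-coeff₁-0 l = trans (coeff₁-⟦⟧ 0 (F α) l) (F-⟦0∷⟧ α l)

InJ⇒InShiftJ-coeff₁-0 : ∀ e P → InJ e P → InShiftJ e (shift (coeff₁ 0 P))
InJ⇒InShiftJ-coeff₁-0 e P (cs , generators , P≈) =
  coeff₁ 0 P , (_ , AllP.map⁺ generators , λ m → trans (coeff₁-⟦⟧ 0 P m) (trans (P≈ (0 ∷ m)) (lincomb-⟦0∷⟧ cs m)))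
  , λ _ → refl

lemma3p3 : (ρ : List ℕ) →
    ((G (0 ∷ ρ) ≈ shift (G ρ)) × NoX1 (G (0 ∷ ρ)))
    × ((b : ℕ) → 0 < b →
       ∃ λ M → (G (b ∷ ρ) ≈ x 1 *S G ((b ∸ 1) ∷ ρ) +S shift M)
               × ((e : ℕ) → InJ e (G (b ∷ ρ)) → InShiftJ e (shift M)))
lemma3p3 ρ = (IsShiftOf⇒≈shift {G (0 ∷ ρ)} {G ρ} (G-0∷-IsShiftOf ρ) , proj₂ (G-0∷-IsShiftOf ρ)) , λ
  { (suc b) _ → coeff₁ 0 (G (suc b ∷ ρ))
              , x₁-decomposition (G (suc b ∷ ρ)) (G (b ∷ ρ)) (G-suc∷-⟦suc∷⟧ ρ b)
              , λ e → InJ⇒InShiftJ-coeff₁-0 e (G (suc b ∷ ρ)) }
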